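{- Let $n_1,n_2$ be integers with $1<n_i\le m$ for $i\in\{1,2\}$, and suppose that a $((n_1,n_2),(1,1))$-MRD code exists in $\mathbb{F}_{q^m}^{n_1+n_2}$. Then $n_i\le m/2$ for every $i\in\{1,2\}$. Moreover: if $n_1=n_2$, then $m\ge n_1+n_2$, with equality if and only if $n_1=n_2=m/2$; if $n_1\ne n_2$, then $m\ge n_1+n_2+1$.
   Context: An $[n,k]_{q^m/q}$ code is a $k$-dim $\mathbb{F}_{q^m}$-subspace of $\mathbb{F}_{q^m}^n$ with rank weight $w(v)=\dim_{\mathbb{F}_q}\langle v_1,\dots,v_n\rangle_{\mathbb{F}_q}$. For $n_i\le m$, an $[n_i,1]_{q^m/q}$ code is MRD if its minimum distance is $n_i$. A $((n_1,n_2),(1,1))$-MRD code is an $[n_1+n_2,2]_{q^m/q}$ code $\mathcal{C}=\mathcal{C}_1\oplus\mathcal{C}_2=\{(c_1,c_2):c_i\in\mathcal{C}_i\}$ with $\mathcal{C}_i\subseteq\mathbb{F}_{q^m}^{n_i}$ MRD codes of parameters $[n_i,1]_{q^m/q}$, such that every codeword $(c_1,c_2)$ with $c_1\ne0$ and $c_2\ne0$ has rank weight at least $n_1+n_2-1$. -}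

module Defs where

open import Level using (Level; _⊔_)
open import Algebra.Bundles using (CommutativeRing)
open import Data.Nat using (ℕ; zero; suc)
import Data.Nat
open import Data.Fin using (Fin; zero; suc)
open import Data.Product using (Σ; ∃; ∃-syntax; _×_; _,_)
open import Data.Vec.Functional using (Vector; _++_)
open import Relation.Nullary using (¬_)

-- Throughout: L is a commutative ring (with setoid equality _≈_) which will be
-- required to be a field (playing the role of F_{q^m}), and K : Carrier → Set k
-- is a predicate cutting out a finite subfield (playing the role of F_q).
module _ {c ℓ : Level} (L : CommutativeRing c ℓ) where
  open CommutativeRing L using (Carrier; _≈_; _+_; _*_; -_; 0#; 1#)

  sumF : ∀ n → (Fin n → Carrier) → Carrier
  sumF zero    f = 0#
  sumF (suc n) f = f zero + sumF n (λ i → f (suc i))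

  record IsField : Set (c ⊔ ℓ) where
    field
      0≉1     : ¬ (0# ≈ 1#)
      inverse : ∀ x → ¬ (x ≈ 0#) → ∃[ y ] (x * y ≈ 1#)

  module _ {k : Level} (K : Carrier → Set k) where

    record IsSubfield : Set (c ⊔ ℓ ⊔ k) where
      field
        K-resp : ∀ {x y} → x ≈ y → K x → K y
        K-0    : K 0#
        K-1    : K 1#
        K-+    : ∀ {x y} → K x → K y → K (x + y)
        K-neg  : ∀ {x} → K x → K (- x)
        K-*    : ∀ {x y} → K x → K y → K (x * y)
        K-inv  : ∀ {x} → K x → ¬ (x ≈ 0#) → ∃[ y ] (K y × x * y ≈ 1#)

    IsFiniteSubset : Set (c ⊔ ℓ ⊔ k)
    IsFiniteSubset = ∃[ q ] Σ (Fin q → Carrier) λ e →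
      (∀ i → K (e i)) × (∀ x → K x → ∃[ i ] (e i ≈ x))

    InKSpan : ∀ {n} → (Fin n → Carrier) → Carrier → Set (c ⊔ ℓ ⊔ k)
    InKSpan {n} v x = Σ (Fin n → Carrier) λ a →
      (∀ i → K (a i)) × (x ≈ sumF n (λ i → a i * v i))

    KLinIndep : ∀ {n} → (Fin n → Carrier) → Set (c ⊔ ℓ ⊔ k)
    KLinIndep {n} u = ∀ (a : Fin n → Carrier) → (∀ i → K (a i)) →
      sumF n (λ i → a i * u i) ≈ 0# → ∀ i → a i ≈ 0#

    HasDegree : ℕ → Set (c ⊔ ℓ ⊔ k)
    HasDegree m = Σ (Fin m → Carrier) λ b → KLinIndep b × (∀ x → InKSpan b x)

    record IsFiniteFieldExtension (m : ℕ) : Set (c ⊔ ℓ ⊔ k) where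
      field
        isField    : IsField
        isSubfield : IsSubfield
        finite     : IsFiniteSubset
        degree     : HasDegree m

    RankWeight : ∀ {n} → Vector Carrier n → ℕ → Set (c ⊔ ℓ ⊔ k)
    RankWeight v r = Σ (Fin r → Carrier) λ u →
      KLinIndep u × (∀ i → InKSpan u (v i)) × (∀ j → InKSpan v (u j))

    RankWeight≥ : ∀ {n} → Vector Carrier n → ℕ → Set (c ⊔ ℓ ⊔ k)
    RankWeight≥ v d = ∀ r → RankWeight v r → d Data.Nat.≤ r

    NonZeroVec : ∀ {n} → Vector Carrier n → Set ℓ
    NonZeroVec v = ∃[ i ] ¬ (v i ≈ 0#)

    _·_ : ∀ {n} → Carrier → Vector Carrier n → Vector Carrier n
    (λ' · g) i = λ' * g i

    -- An [n,1]_{q^m/q} code is the L-line C = L·g spanned by a nonzero g ∈ L^n.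
    -- It is MRD iff its minimum distance is n, i.e. every nonzero codeword λ·g
    -- has rank weight ≥ n (weights are always ≤ n).
    IsMRD1 : ∀ n → Vector Carrier n → Set (c ⊔ ℓ ⊔ k)
    IsMRD1 n g = NonZeroVec g ×
      (∀ λ' → NonZeroVec (λ' · g) → RankWeight≥ (λ' · g) n)

    -- C = C_1 ⊕ C_2 with C_i = L·g_i MRD [n_i,1] codes, and every codeword
    -- (c_1,c_2) with c_1 ≠ 0, c_2 ≠ 0 has rank weight ≥ n_1 + n_2 - 1.
    IsMRD-n1n2-11 : ∀ n₁ n₂ → Vector Carrier n₁ → Vector Carrier n₂ → Set (c ⊔ ℓ ⊔ k)
    IsMRD-n1n2-11 n₁ n₂ g₁ g₂ = IsMRD1 n₁ g₁ × IsMRD1 n₂ g₂ ×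
      (∀ λ₁ λ₂ → NonZeroVec (λ₁ · g₁) → NonZeroVec (λ₂ · g₂) →
        RankWeight≥ ((λ₁ · g₁) ++ (λ₂ · g₂)) (n₁ Data.Nat.+ n₂ Data.Nat.∸ 1))

    MRDCodeExists : ℕ → ℕ → Set (c ⊔ ℓ ⊔ k)
    MRDCodeExists n₁ n₂ = Σ (Vector Carrier n₁) λ g₁ → Σ (Vector Carrier n₂) λ g₂ →
      IsMRD-n1n2-11 n₁ n₂ g₁ g₂

-- Let H be the K-span of the entries h₀, …, h_{n₂-1} of g₂; it has dimension n₂, because the
-- entries of an MRD [n,1] code are K-independent. If 2 n₂ > m, the 2 n₂ elements g₁,₁ hⱼ, g₁,₀ hⱼ
-- of the m-dimensional K-space L are dependent: g₁,₁ α + g₁,₀ γ = 0 with α, γ ∈ H not both 0,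
-- hence α ≠ 0. Then l = α / g₁,₀ puts both l g₁,₀ = α and l g₁,₁ = -γ into H, so the entries of the
-- codeword (l g₁, g₂) are spanned by n₁ - 2 + n₂ of them, contradicting rank weight ≥ n₁ + n₂ - 1.
-- Hence 2 n₂ ≤ m, symmetrically 2 n₁ ≤ m, and the remaining claims are arithmetic.
--
-- Equality with 0 in L is decidable only under double negation (by finiteness of K), which suffices
-- because every conclusion is a decidable inequality of natural numbers.
{-# OPTIONS --safe #-}
module Submission where

open import Defs
open import Level using (Level; _⊔_)
open import Algebra.Bundles using (CommutativeRing)
open import Data.Nat as ℕ using (ℕ; zero; suc; _≤_; _<_; z≤n; s≤s; _≤?_)
import Data.Nat.Properties as ℕₚ
open import Data.Fin as Fin using (Fin; zero; suc; punchIn; punchOut; _↑ˡ_; _↑ʳ_; splitAt)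
open import Data.Fin.Properties using (all?; any?; join-splitAt; punchIn-punchOut)
open import Data.Product using (Σ; ∃-syntax; _×_; _,_; proj₁; proj₂)
open import Data.Sum using (inj₁; inj₂)
open import Data.Empty using (⊥-elim)
open import Data.Vec.Functional using (Vector; _++_; tail; insertAt; removeAt)
open import Data.Vec.Functional.Properties using (insertAt-lookup; insertAt-punchIn; lookup-++ˡ; lookup-++ʳ)
open import Function using (_∘_)
open import Function.Bundles using (_⇔_; mk⇔)
open import Relation.Nullary using (¬_; Dec; yes; no; ¬?)
open import Relation.Nullary.Decidable using (decidable-stable; ¬¬-excluded-middle; map′)
open import Relation.Binary.PropositionalEquality as ≡ using (_≡_; _≢_)
open import Relation.Binary.Definitions using (tri<; tri≈; tri>)

insertAt-∀ : ∀ {a p n} {A : Set a} (P : A → Set p) (xs : Vector A n) (j : Fin (suc n)) (x : A) →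
  (∀ i → P (xs i)) → P x → ∀ i → P (insertAt xs j x i)
insertAt-∀ P xs zero    x Pxs Px zero    = Px
insertAt-∀ P xs zero    x Pxs Px (suc i) = Pxs i
insertAt-∀ {n = suc n} P xs (suc j) x Pxs Px zero    = Pxs zero
insertAt-∀ {n = suc n} P xs (suc j) x Pxs Px (suc i) = insertAt-∀ P (xs ∘ suc) j x (Pxs ∘ suc) Px i

↑-∀ : ∀ {p} m {n} (P : Fin (m ℕ.+ n) → Set p) →
  (∀ i → P (i ↑ˡ n)) → (∀ j → P (m ↑ʳ j)) → ∀ i → P i
↑-∀ m {n} P Pˡ Pʳ i = ≡.subst P (join-splitAt m n i) (by-side (splitAt m i))
  where
  by-side : ∀ s → P (Fin.join m n s)
  by-side (inj₁ i′) = Pˡ i′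
  by-side (inj₂ j′) = Pʳ j′

¬¬-∀-Dec : ∀ {p} q (P : Fin q → Set p) → ¬ ¬ (∀ i → Dec (P i))
¬¬-∀-Dec zero    P k = k (λ ())
¬¬-∀-Dec (suc q) P k = ¬¬-excluded-middle λ P₀? →
  ¬¬-∀-Dec q (P ∘ suc) λ P? → k λ { zero → P₀? ; (suc i) → P? i }

2*n≡n+n : ∀ n → 2 ℕ.* n ≡ n ℕ.+ n
2*n≡n+n n = ≡.cong (n ℕ.+_) (ℕₚ.+-identityʳ n)

module LinearAlgebra {c ℓ : Level} (L : CommutativeRing c ℓ) where
  open CommutativeRing L hiding (zero)
  open import Algebra.Properties.Ring ring using (-1*x≈-x; -‿distribˡ-*; -‿distribʳ-*; +-inverseˡ-unique)
  open import Algebra.Properties.Semiring.Sum semiring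
    using (sum; sum-cong-≋; sum-replicate-zero; ∑-distrib-+; sum-remove; *-distribˡ-sum; *-distribʳ-sum)
  open import Relation.Binary.Reasoning.Setoid setoid
  open import Algebra.Properties.CommutativeSemigroup +-commutativeSemigroup using (interchange)
  open import Algebra.Properties.CommutativeSemigroup *-commutativeSemigroup
    using (xy∙z≈y∙xz; xy∙z≈x∙zy; xy∙z≈y∙zx; x∙yz≈yx∙z)

  variable
    m n q d : ℕ
    r r′ s t t′ x y z : Carrier
    a u v v′ w : Vector Carrier n

  t*x+r≈0⇒x≈-y*r : t * x + r ≈ 0# → t * y ≈ 1# → x ≈ - y * r
  t*x+r≈0⇒x≈-y*r {t} {x} {r} {y} tx+r≈0 ty≈1 = begin
    x             ≈⟨ *-identityˡ x ⟨
    1# * x        ≈⟨ *-congʳ ty≈1 ⟨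
    t * y * x     ≈⟨ xy∙z≈y∙xz t y x ⟩
    y * (t * x)   ≈⟨ *-congˡ (+-inverseˡ-unique _ _ tx+r≈0) ⟩
    y * - r       ≈⟨ -‿distribʳ-* y r ⟨
    - (y * r)     ≈⟨ -‿distribˡ-* y r ⟩
    - y * r       ∎

  t*y≈1⇒x-xyt≈0 : t * y ≈ 1# → x + - (x * y) * t ≈ 0#
  t*y≈1⇒x-xyt≈0 {t} {y} {x} ty≈1 = begin
    x + - (x * y) * t   ≈⟨ +-congˡ (-‿distribˡ-* (x * y) t) ⟨
    x + - (x * y * t)   ≈⟨ +-congˡ (-‿cong (xy∙z≈x∙zy x y t)) ⟩
    x + - (x * (t * y)) ≈⟨ +-congˡ (-‿cong (trans (*-congˡ ty≈1) (*-identityʳ x))) ⟩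
    x + - x             ≈⟨ -‿inverseʳ x ⟩
    0#                  ∎

  eliminate-common-term : x ≈ t * z + r → y ≈ t′ * z + r′ → t′ + s * t ≈ 0# → y + s * x ≈ r′ + s * r
  eliminate-common-term {x} {t} {z} {r} {y} {t′} {r′} {s} x≈ y≈ t′+st≈0 = begin
    y + s * x                               ≈⟨ +-cong y≈ (*-congˡ x≈) ⟩
    (t′ * z + r′) + s * (t * z + r)         ≈⟨ +-congˡ (trans (distribˡ s _ _) (+-congʳ (sym (*-assoc s t z)))) ⟩
    (t′ * z + r′) + (s * t * z + s * r)     ≈⟨ interchange _ _ _ _ ⟩
    (t′ * z + s * t * z) + (r′ + s * r)     ≈⟨ +-congʳ (distribʳ z t′ (s * t)) ⟨
    (t′ + s * t) * z + (r′ + s * r)         ≈⟨ +-congʳ (trans (*-congʳ t′+st≈0) (zeroˡ z)) ⟩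
    0# + (r′ + s * r)                       ≈⟨ +-identityˡ _ ⟩
    r′ + s * r                              ∎

  y*x*z≈x : z * y ≈ 1# → y * x * z ≈ x
  y*x*z≈x {z} {y} {x} zy≈1 = trans (xy∙z≈y∙zx y x z) (trans (*-congˡ zy≈1) (*-identityʳ x))

  y*x*t≈-r : z * y ≈ 1# → t * x + z * r ≈ 0# → y * x * t ≈ - r
  y*x*t≈-r {z} {y} {t} {x} {r} zy≈1 tx+zr≈0 = begin
    y * x * t        ≈⟨ xy∙z≈x∙zy y x t ⟩
    y * (t * x)      ≈⟨ *-congˡ (+-inverseˡ-unique _ _ tx+zr≈0) ⟩
    y * - (z * r)    ≈⟨ -‿distribʳ-* y _ ⟨
    - (y * (z * r))  ≈⟨ -‿cong (x∙yz≈yx∙z y z r) ⟩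
    - (z * y * r)    ≈⟨ -‿cong (trans (*-congʳ zy≈1) (*-identityˡ r)) ⟩
    - r              ∎

  sumF≡sum : ∀ n (f : Vector Carrier n) → sumF L n f ≡ sum f
  sumF≡sum zero    f = ≡.refl
  sumF≡sum (suc n) f = ≡.cong (f zero +_) (sumF≡sum n (f ∘ suc))

  sumF-cong : ∀ n {f g : Vector Carrier n} → (∀ i → f i ≈ g i) → sumF L n f ≈ sumF L n g
  sumF-cong n {f} {g} f≈g rewrite sumF≡sum n f | sumF≡sum n g = sum-cong-≋ f≈g

  sumF-zero : ∀ n {f : Vector Carrier n} → (∀ i → f i ≈ 0#) → sumF L n f ≈ 0#
  sumF-zero n f≈0 = trans (sumF-cong n f≈0) (trans (reflexive (sumF≡sum n _)) (sum-replicate-zero n))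

  sumF-+ : ∀ (f g : Vector Carrier n) → sumF L n (λ i → f i + g i) ≈ sumF L n f + sumF L n g
  sumF-+ {n} f g rewrite sumF≡sum n (λ i → f i + g i) | sumF≡sum n f | sumF≡sum n g = ∑-distrib-+ f g

  *-distribˡ-sumF : ∀ x (f : Vector Carrier n) → x * sumF L n f ≈ sumF L n (λ i → x * f i)
  *-distribˡ-sumF {n} x f rewrite sumF≡sum n f | sumF≡sum n (λ i → x * f i) = *-distribˡ-sum x f

  *-distribʳ-sumF : ∀ x (f : Vector Carrier n) → sumF L n f * x ≈ sumF L n (λ i → f i * x)
  *-distribʳ-sumF {n} x f rewrite sumF≡sum n f | sumF≡sum n (λ i → f i * x) = *-distribʳ-sum x f

  sumF-remove : ∀ (j : Fin (suc n)) (f : Vector Carrier (suc n)) →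
    sumF L (suc n) f ≈ f j + sumF L n (removeAt f j)
  sumF-remove {n} j f rewrite sumF≡sum (suc n) f | sumF≡sum n (removeAt f j) = sum-remove f

  sumF-↑ : ∀ m (f : Vector Carrier (m ℕ.+ n)) →
    sumF L (m ℕ.+ n) f ≈ sumF L m (λ i → f (i ↑ˡ n)) + sumF L n (λ j → f (m ↑ʳ j))
  sumF-↑ zero    f = sym (+-identityˡ _)
  sumF-↑ (suc m) f = trans (+-congˡ (sumF-↑ m (f ∘ suc))) (sym (+-assoc _ _ _))

  lincomb : Vector Carrier n → Vector Carrier n → Carrier
  lincomb {n} a w = sumF L n (λ i → a i * w i)

  lincomb-zero : ∀ (w : Vector Carrier n) → (∀ i → a i ≈ 0#) → lincomb a w ≈ 0#
  lincomb-zero w a≈0 = sumF-zero _ (λ i → trans (*-congʳ (a≈0 i)) (zeroˡ _))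

  lincomb-+ : ∀ (a b w : Vector Carrier n) → lincomb (λ i → a i + b i) w ≈ lincomb a w + lincomb b w
  lincomb-+ a b w = trans (sumF-cong _ (λ i → distribʳ (w i) (a i) (b i)))
                          (sumF-+ (λ i → a i * w i) (λ i → b i * w i))

  *-distribˡ-lincomb : ∀ x (a w : Vector Carrier n) → x * lincomb a w ≈ lincomb (λ i → x * a i) w
  *-distribˡ-lincomb x a w =
    trans (*-distribˡ-sumF x (λ i → a i * w i)) (sumF-cong _ (λ i → sym (*-assoc x (a i) (w i))))

  lincomb-*ʳ : ∀ x (a w : Vector Carrier n) → lincomb a (λ i → x * w i) ≈ x * lincomb a w
  lincomb-*ʳ x a w = trans (sumF-cong _ swap) (sym (*-distribˡ-sumF x (λ i → a i * w i)))
    where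
    swap : ∀ i → a i * (x * w i) ≈ x * (a i * w i)
    swap i = trans (sym (*-assoc _ _ _)) (trans (*-congʳ (*-comm _ _)) (*-assoc _ _ _))

  lincomb-+-* : ∀ (a u e : Vector Carrier n) x →
    lincomb a (λ i → u i + e i * x) ≈ lincomb a u + lincomb a e * x
  lincomb-+-* {n} a u e x = begin
    lincomb a (λ i → u i + e i * x)
      ≈⟨ sumF-cong n (λ i → trans (distribˡ _ _ _) (+-congˡ (sym (*-assoc _ _ _)))) ⟩
    sumF L n (λ i → a i * u i + a i * e i * x)   ≈⟨ sumF-+ (λ i → a i * u i) (λ i → a i * e i * x) ⟩
    lincomb a u + sumF L n (λ i → a i * e i * x) ≈⟨ +-congˡ (sym (*-distribʳ-sumF x (λ i → a i * e i))) ⟩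
    lincomb a u + lincomb a e * x                ∎

  lincomb-remove : ∀ (j : Fin (suc n)) a w →
    lincomb a w ≈ a j * w j + lincomb (removeAt a j) (removeAt w j)
  lincomb-remove j a w = sumF-remove j (λ i → a i * w i)

  lincomb-insertAt : ∀ (j : Fin (suc n)) t a w →
    lincomb (insertAt a j t) w ≈ t * w j + lincomb a (removeAt w j)
  lincomb-insertAt j t a w = trans (lincomb-remove j (insertAt a j t) w) (+-cong
    (*-congʳ (reflexive (insertAt-lookup a j t)))
    (sumF-cong _ (λ i → *-congʳ (reflexive (insertAt-punchIn a j t i)))))

  lincomb-++ : ∀ (a : Vector Carrier (m ℕ.+ n)) (u : Vector Carrier m) (v : Vector Carrier n) →
    lincomb a (u ++ v) ≈ lincomb (λ i → a (i ↑ˡ n)) u + lincomb (λ j → a (m ↑ʳ j)) v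
  lincomb-++ {m} a u v = trans (sumF-↑ m _) (+-cong
    (sumF-cong _ (λ i → *-congˡ (reflexive (lookup-++ˡ u v i))))
    (sumF-cong _ (λ j → *-congˡ (reflexive (lookup-++ʳ u v j)))))

  unitVector : Fin (suc n) → Vector Carrier (suc n)
  unitVector j = insertAt (λ _ → 0#) j 1#

  lincomb-unitVector : ∀ (j : Fin (suc n)) w → lincomb (unitVector j) w ≈ w j
  lincomb-unitVector j w = trans (lincomb-insertAt j 1# _ w)
    (trans (+-cong (*-identityˡ _) (lincomb-zero (removeAt w j) (λ _ → refl))) (+-identityʳ _))

  module OverSubfield {k : Level} {K : Carrier → Set k} (K-subfield : IsSubfield L K) where
    open IsSubfield K-subfield

    infix 4 _∈⟨_⟩ _⊆⟨_⟩

    _∈⟨_⟩ : Carrier → Vector Carrier n → Set (c ⊔ ℓ ⊔ k)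
    x ∈⟨ w ⟩ = InKSpan L K w x

    _⊆⟨_⟩ : Vector Carrier m → Vector Carrier n → Set (c ⊔ ℓ ⊔ k)
    u ⊆⟨ w ⟩ = ∀ i → u i ∈⟨ w ⟩

    K-lincomb : ∀ {n} {a b : Vector Carrier n} → (∀ i → K (a i)) → (∀ i → K (b i)) → K (lincomb a b)
    K-lincomb {zero}  _  _  = K-0
    K-lincomb {suc n} Ka Kb = K-+ (K-* (Ka zero) (Kb zero)) (K-lincomb (Ka ∘ suc) (Kb ∘ suc))

    K-unitVector : ∀ (j : Fin (suc n)) i → K (unitVector j i)
    K-unitVector j = insertAt-∀ K _ j 1# (λ _ → K-0) K-1

    ∈⟨⟩-resp-≈ : x ≈ y → x ∈⟨ w ⟩ → y ∈⟨ w ⟩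
    ∈⟨⟩-resp-≈ x≈y (a , Ka , x≈) = a , Ka , trans (sym x≈y) x≈

    0∈⟨⟩ : 0# ∈⟨ w ⟩
    0∈⟨⟩ {w = w} = (λ _ → 0#) , (λ _ → K-0) , sym (lincomb-zero w (λ _ → refl))

    +-∈⟨⟩ : x ∈⟨ w ⟩ → y ∈⟨ w ⟩ → x + y ∈⟨ w ⟩
    +-∈⟨⟩ (a , Ka , x≈) (b , Kb , y≈) =
      (λ i → a i + b i) , (λ i → K-+ (Ka i) (Kb i)) , trans (+-cong x≈ y≈) (sym (lincomb-+ a b _))

    *-∈⟨⟩ : K t → x ∈⟨ w ⟩ → t * x ∈⟨ w ⟩
    *-∈⟨⟩ {t} Kt (a , Ka , x≈) =
      (λ i → t * a i) , (λ i → K-* Kt (Ka i)) , trans (*-congˡ x≈) (*-distribˡ-lincomb t a _)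

    -‿∈⟨⟩ : x ∈⟨ w ⟩ → - x ∈⟨ w ⟩
    -‿∈⟨⟩ x∈ = ∈⟨⟩-resp-≈ (-1*x≈-x _) (*-∈⟨⟩ (K-neg K-1) x∈)

    lookup-∈⟨⟩ : ∀ {n} (w : Vector Carrier n) j → w j ∈⟨ w ⟩
    lookup-∈⟨⟩ {suc n} w j = unitVector j , K-unitVector j , sym (lincomb-unitVector j w)

    lincomb-∈⟨⟩ : ∀ {n q} {w : Vector Carrier q} {a u : Vector Carrier n} →
      (∀ i → K (a i)) → u ⊆⟨ w ⟩ → lincomb a u ∈⟨ w ⟩
    lincomb-∈⟨⟩ {zero}  _  _   = 0∈⟨⟩
    lincomb-∈⟨⟩ {suc n} Ka u⊆ = +-∈⟨⟩ (*-∈⟨⟩ (Ka zero) (u⊆ zero)) (lincomb-∈⟨⟩ (Ka ∘ suc) (u⊆ ∘ suc))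

    ∈⟨⟩-mono : u ⊆⟨ w ⟩ → x ∈⟨ u ⟩ → x ∈⟨ w ⟩
    ∈⟨⟩-mono u⊆w (a , Ka , x≈) = ∈⟨⟩-resp-≈ (sym x≈) (lincomb-∈⟨⟩ Ka u⊆w)

    ∈⟨tail⟩ : ∀ (w : Vector Carrier (suc n)) (x∈ : x ∈⟨ w ⟩) →
      proj₁ x∈ zero ≈ 0# → x ∈⟨ tail w ⟩
    ∈⟨tail⟩ w (a , Ka , x≈) a₀≈0 = a ∘ suc , Ka ∘ suc ,
      trans x≈ (trans (+-congʳ (trans (*-congʳ a₀≈0) (zeroˡ (w zero)))) (+-identityˡ _))

    ⊆⟨⟩-trans : u ⊆⟨ v ⟩ → v ⊆⟨ w ⟩ → u ⊆⟨ w ⟩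
    ⊆⟨⟩-trans u⊆v v⊆w i = ∈⟨⟩-mono v⊆w (u⊆v i)

    ⊆⟨⟩-reflexive : ∀ {u : Vector Carrier n} (w : Vector Carrier n) → (∀ i → u i ≈ w i) → u ⊆⟨ w ⟩
    ⊆⟨⟩-reflexive w u≈w i = ∈⟨⟩-resp-≈ (sym (u≈w i)) (lookup-∈⟨⟩ w i)

    removeAt-⊆⟨⟩ : ∀ (w : Vector Carrier (suc n)) j → removeAt w j ⊆⟨ w ⟩
    removeAt-⊆⟨⟩ w j i = lookup-∈⟨⟩ w (punchIn j i)

    ++-⊆⟨⟩ : ∀ {m n q} {u : Vector Carrier m} {v : Vector Carrier n} {w : Vector Carrier q} →
      u ⊆⟨ w ⟩ → v ⊆⟨ w ⟩ → (u ++ v) ⊆⟨ w ⟩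
    ++-⊆⟨⟩ {m = m} u⊆w v⊆w i with splitAt m i
    ... | inj₁ i′ = u⊆w i′
    ... | inj₂ j′ = v⊆w j′

    ⊆⟨⟩-++ˡ : ∀ (u : Vector Carrier m) (v : Vector Carrier n) → u ⊆⟨ u ++ v ⟩
    ⊆⟨⟩-++ˡ u v i = ∈⟨⟩-resp-≈ (reflexive (lookup-++ˡ u v i)) (lookup-∈⟨⟩ (u ++ v) _)

    ⊆⟨⟩-++ʳ : ∀ (u : Vector Carrier m) (v : Vector Carrier n) → v ⊆⟨ u ++ v ⟩
    ⊆⟨⟩-++ʳ u v j = ∈⟨⟩-resp-≈ (reflexive (lookup-++ʳ u v j)) (lookup-∈⟨⟩ (u ++ v) _)

    ++-comm-⊆⟨⟩ : ∀ (u : Vector Carrier m) (v : Vector Carrier n) → (u ++ v) ⊆⟨ v ++ u ⟩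
    ++-comm-⊆⟨⟩ u v = ++-⊆⟨⟩ {u = u} {v} (⊆⟨⟩-++ʳ v u) (⊆⟨⟩-++ˡ v u)

    ⊆⟨1*⟩ : ∀ (g : Vector Carrier n) → g ⊆⟨ (λ i → 1# * g i) ⟩
    ⊆⟨1*⟩ g = ⊆⟨⟩-reflexive _ (λ i → sym (*-identityˡ (g i)))

    1*-⊆⟨⟩ : ∀ (g : Vector Carrier n) → (λ i → 1# * g i) ⊆⟨ g ⟩
    1*-⊆⟨⟩ g = ⊆⟨⟩-reflexive g (λ i → *-identityˡ (g i))

    RankWeight-resp : v ⊆⟨ v′ ⟩ → v′ ⊆⟨ v ⟩ → RankWeight L K v′ d → RankWeight L K v d
    RankWeight-resp v⊆v′ v′⊆v (u , u-indep , v′⊆u , u⊆v′) =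
      u , u-indep , ⊆⟨⟩-trans v⊆v′ v′⊆u , ⊆⟨⟩-trans u⊆v′ v′⊆v

    RankWeight≥-resp : v ⊆⟨ v′ ⟩ → v′ ⊆⟨ v ⟩ → RankWeight≥ L K v d → RankWeight≥ L K v′ d
    RankWeight≥-resp v⊆v′ v′⊆v v≥d r = v≥d r ∘ RankWeight-resp v⊆v′ v′⊆v

    isMRD-n1n2-11-sym : ∀ {n₁ n₂} {g₁ : Vector Carrier n₁} {g₂ : Vector Carrier n₂} →
      IsMRD-n1n2-11 L K n₁ n₂ g₁ g₂ → IsMRD-n1n2-11 L K n₂ n₁ g₂ g₁
    isMRD-n1n2-11-sym {n₁} {n₂} {g₁} {g₂} (mrd₁ , mrd₂ , mixed) = mrd₂ , mrd₁ , λ t₂ t₁ nz₂ nz₁ →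
      ≡.subst (RankWeight≥ L K _) (≡.cong (ℕ._∸ 1) (ℕₚ.+-comm n₁ n₂))
        (RankWeight≥-resp (++-comm-⊆⟨⟩ (λ i → t₁ * g₁ i) (λ i → t₂ * g₂ i))
                           (++-comm-⊆⟨⟩ (λ i → t₂ * g₂ i) (λ i → t₁ * g₁ i))
                           (mixed t₁ t₂ nz₁ nz₂))

    Dependent : Vector Carrier n → Set (c ⊔ ℓ ⊔ k)
    Dependent {n} w = Σ (Vector Carrier n) λ a →
      (∀ i → K (a i)) × lincomb a w ≈ 0# × ∃[ j ] ¬ (a j ≈ 0#)

    lookup∈⟨removeAt⟩⇒⊆⟨removeAt⟩ : ∀ {n} {w : Vector Carrier (suc n)} j →
      w j ∈⟨ removeAt w j ⟩ → w ⊆⟨ removeAt w j ⟩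
    lookup∈⟨removeAt⟩⇒⊆⟨removeAt⟩ {w = w} j wⱼ∈ i with i Fin.≟ j
    ... | yes ≡.refl = wⱼ∈
    ... | no i≢j     =
      ∈⟨⟩-resp-≈ (reflexive (≡.cong w (punchIn-punchOut j≢i))) (lookup-∈⟨⟩ (removeAt w j) (punchOut j≢i))
      where j≢i = i≢j ∘ ≡.sym

    dependent⇒⊆⟨removeAt⟩ : ∀ (w : Vector Carrier (suc n)) → Dependent w →
      ∃[ j ] w ⊆⟨ removeAt w j ⟩
    dependent⇒⊆⟨removeAt⟩ w (a , Ka , rel , j , aⱼ≉0) with K-inv (Ka j) aⱼ≉0
    ... | y , Ky , aⱼy≈1 = j , lookup∈⟨removeAt⟩⇒⊆⟨removeAt⟩ j
      (∈⟨⟩-resp-≈ (sym wⱼ≈) (*-∈⟨⟩ (K-neg Ky) (removeAt a j , Ka ∘ punchIn j , refl)))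
      where
      wⱼ≈ : w j ≈ - y * lincomb (removeAt a j) (removeAt w j)
      wⱼ≈ = t*x+r≈0⇒x≈-y*r (trans (sym (lincomb-remove j a w)) rel) aⱼy≈1

    eliminate-independent : ∀ {n} {v : Vector Carrier (suc n)} {e : Vector Carrier n} →
      KLinIndep L K v → ∀ k → (∀ i → K (e i)) → KLinIndep L K (λ i → v (punchIn k i) + e i * v k)
    eliminate-independent {v = v} {e} v-indep k Ke a Ka rel i =
      trans (sym (reflexive (insertAt-punchIn a k aₖ i)))
        (v-indep (insertAt a k aₖ) (insertAt-∀ K a k aₖ Ka (K-lincomb Ka Ke)) rel′ (punchIn k i))
      where
      aₖ = lincomb a e
      rel′ : lincomb (insertAt a k aₖ) v ≈ 0#
      rel′ = begin
        lincomb (insertAt a k aₖ) v                   ≈⟨ lincomb-insertAt k aₖ a v ⟩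
        aₖ * v k + lincomb a (removeAt v k)           ≈⟨ +-comm _ _ ⟩
        lincomb a (removeAt v k) + aₖ * v k           ≈⟨ lincomb-+-* a (removeAt v k) e (v k) ⟨
        lincomb a (λ i → v (punchIn k i) + e i * v k) ≈⟨ rel ⟩
        0#                                            ∎

    -- One elimination step of the Steinitz exchange: v k has a nonzero coefficient on w₀,
    -- so adding K-multiples of v k to the other entries clears their w₀-coefficients.
    eliminate-head : ∀ (v : Vector Carrier (suc n)) (w : Vector Carrier (suc q)) (v⊆w : v ⊆⟨ w ⟩) k →
      ¬ proj₁ (v⊆w k) zero ≈ 0# →
      Σ (Vector Carrier n) λ e → (∀ i → K (e i)) × (λ i → v (punchIn k i) + e i * v k) ⊆⟨ tail w ⟩
    eliminate-head {n} {q} v w v⊆w k cₖ₀≉0 with K-inv (proj₁ (proj₂ (v⊆w k)) zero) cₖ₀≉0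
    ... | y , Ky , cₖ₀y≈1 = e , Ke , v′⊆
      where
      coeff : Fin (suc n) → Vector Carrier (suc q)
      coeff x = proj₁ (v⊆w x)
      Kc : ∀ x i → K (coeff x i)
      Kc x = proj₁ (proj₂ (v⊆w x))
      e : Vector Carrier n
      e i = - (coeff (punchIn k i) zero * y)
      Ke : ∀ i → K (e i)
      Ke i = K-neg (K-* (Kc (punchIn k i) zero) Ky)
      tail∈ : ∀ x → lincomb (coeff x ∘ suc) (tail w) ∈⟨ tail w ⟩
      tail∈ x = coeff x ∘ suc , Kc x ∘ suc , refl
      v′⊆ : (λ i → v (punchIn k i) + e i * v k) ⊆⟨ tail w ⟩
      v′⊆ i = ∈⟨⟩-resp-≈ (sym (eliminate-common-term (proj₂ (proj₂ (v⊆w k)))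
                                                      (proj₂ (proj₂ (v⊆w (punchIn k i))))
                                                      (t*y≈1⇒x-xyt≈0 cₖ₀y≈1)))
                         (+-∈⟨⟩ (tail∈ (punchIn k i)) (*-∈⟨⟩ (Ke i) (tail∈ k)))

    module _ (L-field : IsField L) where
      open IsField L-field

      ≉0-*-cancelˡ : ¬ x ≈ 0# → x * y ≈ 0# → y ≈ 0#
      ≉0-*-cancelˡ {x} {y} x≉0 xy≈0 with inverse x x≉0
      ... | x⁻¹ , xx⁻¹≈1 = begin
        y              ≈⟨ y*x*z≈x xx⁻¹≈1 ⟨
        x⁻¹ * y * x    ≈⟨ xy∙z≈x∙zy x⁻¹ y x ⟩
        x⁻¹ * (x * y)  ≈⟨ *-congˡ xy≈0 ⟩
        x⁻¹ * 0#       ≈⟨ zeroʳ x⁻¹ ⟩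
        0#             ∎

      independent⇒≉0 : ∀ {n} {w : Vector Carrier n} → KLinIndep L K w → ∀ j → ¬ w j ≈ 0#
      independent⇒≉0 {suc n} {w} w-indep j wⱼ≈0 =
        0≉1 (sym (trans (sym (reflexive (insertAt-lookup _ j 1#)))
                        (w-indep (unitVector j) (K-unitVector j) (trans (lincomb-unitVector j w) wⱼ≈0) j)))

      module _ (_≟0 : ∀ x → Dec (x ≈ 0#)) where

        ¬dependent⇒independent : ∀ (w : Vector Carrier n) → ¬ Dependent w → KLinIndep L K w
        ¬dependent⇒independent _ ¬dep a Ka rel i =
          decidable-stable (a i ≟0) (λ aᵢ≉0 → ¬dep (a , Ka , rel , i , aᵢ≉0))

        rankWeight≥⇒≤ : ∀ {n q d} {v : Vector Carrier n} (w : Vector Carrier q) →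
          RankWeight≥ L K v d → v ⊆⟨ w ⟩ → w ⊆⟨ v ⟩ → d ≤ q
        rankWeight≥⇒≤ {q = zero} w v≥d v⊆w w⊆v = v≥d 0 (w , (λ _ _ _ ()) , v⊆w , w⊆v)
        rankWeight≥⇒≤ {q = suc q} {d} w v≥d v⊆w w⊆v = decidable-stable (d ≤? suc q) λ d≰ →
          d≰ (v≥d (suc q) (w , ¬dependent⇒independent w (d≰ ∘ shrink) , v⊆w , w⊆v))
          where
          shrink : Dependent w → d ≤ suc q
          shrink dep with dependent⇒⊆⟨removeAt⟩ w dep
          ... | j , w⊆ = ℕₚ.m≤n⇒m≤1+n (rankWeight≥⇒≤ (removeAt w j) v≥d
                           (⊆⟨⟩-trans v⊆w w⊆) (⊆⟨⟩-trans (removeAt-⊆⟨⟩ w j) w⊆v))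

        mrd⇒independent : ∀ {n} {g : Vector Carrier n} → IsMRD1 L K n g → KLinIndep L K g
        mrd⇒independent {zero}      _                  _ _ _ ()
        mrd⇒independent {suc n} {g} ((i , gᵢ≉0) , mrd) = ¬dependent⇒independent g λ dep →
          let j , g⊆ = dependent⇒⊆⟨removeAt⟩ g dep in
          ℕₚ.1+n≰n (rankWeight≥⇒≤ {v = λ i → 1# * g i} (removeAt g j)
            (mrd 1# (i , gᵢ≉0 ∘ trans (sym (*-identityˡ _))))
            (⊆⟨⟩-trans {v = g} {w = removeAt g j} (1*-⊆⟨⟩ g) g⊆)
            (⊆⟨⟩-trans {u = removeAt g j} {v = g} {w = λ i → 1# * g i} (removeAt-⊆⟨⟩ g j) (⊆⟨1*⟩ g)))

        rankWeight≥-drop₂ : ∀ {a p d} (u : Vector Carrier (suc (suc a))) (h : Vector Carrier p) →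
          RankWeight≥ L K (u ++ h) d → u zero ∈⟨ h ⟩ → u (suc zero) ∈⟨ h ⟩ → d ≤ a ℕ.+ p
        rankWeight≥-drop₂ u h u++h≥d u₀∈ u₁∈ = rankWeight≥⇒≤ {v = u ++ h} u″ u++h≥d
          (++-⊆⟨⟩ {u = u} {h} {w = u″} u⊆u″ (⊆⟨⟩-++ʳ (tail (tail u)) h))
          (++-⊆⟨⟩ {u = tail (tail u)} {h} {w = u ++ h} (λ i → ⊆⟨⟩-++ˡ u h (suc (suc i))) (⊆⟨⟩-++ʳ u h))
          where
          u″ = (tail (tail u)) ++ h
          u⊆u″ : u ⊆⟨ u″ ⟩
          u⊆u″ zero          = ∈⟨⟩-mono (⊆⟨⟩-++ʳ (tail (tail u)) h) u₀∈
          u⊆u″ (suc zero)    = ∈⟨⟩-mono (⊆⟨⟩-++ʳ (tail (tail u)) h) u₁∈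
          u⊆u″ (suc (suc i)) = ⊆⟨⟩-++ˡ (tail (tail u)) h i

        independent⇒≤ : ∀ {n q} {v : Vector Carrier n} {w : Vector Carrier q} →
          KLinIndep L K v → v ⊆⟨ w ⟩ → n ≤ q
        independent⇒≤ {zero}               _       _   = z≤n
        independent⇒≤ {suc n} {zero}  {v}   v-indep v⊆w =
          ⊥-elim (independent⇒≉0 {w = v} v-indep zero (proj₂ (proj₂ (v⊆w zero))))
        independent⇒≤ {suc n} {suc q} {v} {w} v-indep v⊆w with any? (λ i → ¬? (proj₁ (v⊆w i) zero ≟0))
        ... | yes (k , cₖ₀≉0) = let e , Ke , v′⊆ = eliminate-head v w v⊆w k cₖ₀≉0 in
          s≤s (independent⇒≤ {w = tail w} (eliminate-independent {v = v} {e} v-indep k Ke) v′⊆)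
        ... | no ∄k = ℕₚ.m≤n⇒m≤1+n (independent⇒≤ {v = v} {tail w} v-indep λ i →
          ∈⟨tail⟩ w (v⊆w i) (decidable-stable (_ ≟0) (∄k ∘ (i ,_))))

        common-scaling : ∀ {m p g₀ g₁} (h : Vector Carrier p) → HasDegree L K m → ¬ g₀ ≈ 0# →
          KLinIndep L K h → m < p ℕ.+ p → ¬ ¬ (∃[ l ] ¬ (l * g₀ ≈ 0#) × l * g₀ ∈⟨ h ⟩ × l * g₁ ∈⟨ h ⟩)
        common-scaling {p = p} {g₀} {g₁} h (b , _ , b-spans) g₀≉0 h-indep m<2p ¬scaling =
          ℕₚ.<⇒≱ m<2p (independent⇒≤ {v = F} {b} (¬dependent⇒independent F (¬scaling ∘ scaling))
                                                  (b-spans ∘ F))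
          where
          F : Vector Carrier (p ℕ.+ p)
          F = (λ j → g₁ * h j) ++ (λ j → g₀ * h j)
          scaling : Dependent F → ∃[ l ] ¬ (l * g₀ ≈ 0#) × l * g₀ ∈⟨ h ⟩ × l * g₁ ∈⟨ h ⟩
          scaling (a , Ka , rel , j , aⱼ≉0) = by-α (α ≟0)
            where
            aˡ aʳ : Vector Carrier p
            aˡ i = a (i ↑ˡ p)
            aʳ i = a (p ↑ʳ i)
            α γ : Carrier
            α = lincomb aˡ h
            γ = lincomb aʳ h
            g₁α+g₀γ≈0 : g₁ * α + g₀ * γ ≈ 0#
            g₁α+g₀γ≈0 = begin
              g₁ * α + g₀ * γ
                ≈⟨ +-cong (lincomb-*ʳ g₁ aˡ h) (lincomb-*ʳ g₀ aʳ h) ⟨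
              lincomb aˡ (λ i → g₁ * h i) + lincomb aʳ (λ i → g₀ * h i)
                ≈⟨ lincomb-++ a (λ i → g₁ * h i) (λ i → g₀ * h i) ⟨
              lincomb a F
                ≈⟨ rel ⟩
              0# ∎
            by-α : Dec (α ≈ 0#) → ∃[ l ] ¬ (l * g₀ ≈ 0#) × l * g₀ ∈⟨ h ⟩ × l * g₁ ∈⟨ h ⟩
            by-α (yes α≈0) = ⊥-elim (aⱼ≉0 (↑-∀ p (λ i → a i ≈ 0#)
                (h-indep aˡ (Ka ∘ (_↑ˡ p)) α≈0) (h-indep aʳ (Ka ∘ (p ↑ʳ_)) γ≈0) j))
              where
              γ≈0 : γ ≈ 0#
              γ≈0 = ≉0-*-cancelˡ g₀≉0 (begin
                g₀ * γ                ≈⟨ +-identityˡ _ ⟨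
                0# + g₀ * γ           ≈⟨ +-congʳ (trans (*-congˡ α≈0) (zeroʳ g₁)) ⟨
                g₁ * α + g₀ * γ       ≈⟨ g₁α+g₀γ≈0 ⟩
                0#                    ∎)
            by-α (no α≉0) with inverse g₀ g₀≉0
            ... | y , g₀y≈1 = y * α , α≉0 ∘ trans (sym yαg₀≈α) ,
              ∈⟨⟩-resp-≈ (sym yαg₀≈α) (aˡ , Ka ∘ (_↑ˡ p) , refl) ,
              ∈⟨⟩-resp-≈ (sym (y*x*t≈-r g₀y≈1 g₁α+g₀γ≈0)) (-‿∈⟨⟩ (aʳ , Ka ∘ (p ↑ʳ_) , refl))
              where
              yαg₀≈α : y * α * g₀ ≈ α
              yαg₀≈α = y*x*z≈x g₀y≈1

        twice-length≤degree : ∀ {m n₁ n₂} {g₁ : Vector Carrier n₁} {g₂ : Vector Carrier n₂} →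
          HasDegree L K m → 1 < n₁ → IsMRD-n1n2-11 L K n₁ n₂ g₁ g₂ → 2 ℕ.* n₂ ≤ m
        twice-length≤degree {m} {n₂ = n₂} {g₁} {g₂} degree (s≤s (s≤s z≤n))
                            (mrd₁ , mrd₂@((i , g₂ᵢ≉0) , _) , mixed) =
          decidable-stable (2 ℕ.* n₂ ≤? m) λ 2n₂≰m →
            common-scaling g₂ degree (independent⇒≉0 {w = g₁} (mrd⇒independent mrd₁) zero)
              (mrd⇒independent mrd₂) (≡.subst (m <_) (2*n≡n+n n₂) (ℕₚ.≰⇒> 2n₂≰m))
              λ (l , lg₁₀≉0 , lg₁₀∈ , lg₁₁∈) → ℕₚ.1+n≰n
                (rankWeight≥-drop₂ (λ i → l * g₁ i) (λ i → 1# * g₂ i)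
                  (mixed l 1# (zero , lg₁₀≉0) (i , g₂ᵢ≉0 ∘ trans (sym (*-identityˡ _))))
                  (∈⟨⟩-mono (⊆⟨1*⟩ g₂) lg₁₀∈) (∈⟨⟩-mono (⊆⟨1*⟩ g₂) lg₁₁∈))

  ¬¬-decidable-≈0 : ∀ {k m} {K : Carrier → Set k} → IsFiniteSubset L K → HasDegree L K m →
    ¬ ¬ (∀ x → Dec (x ≈ 0#))
  ¬¬-decidable-≈0 (q , elem , _ , enumerates) (b , b-indep , b-spans) ¬dec =
    ¬¬-∀-Dec q (λ i → elem i ≈ 0#) (¬dec ∘ decide)
    where
    decide : (∀ i → Dec (elem i ≈ 0#)) → ∀ x → Dec (x ≈ 0#)
    decide elem≟0 x with b-spans x
    ... | coord , K-coord , x≈ = map′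
      (λ all≈0 → trans x≈ (lincomb-zero b (λ i → trans (sym (index≈ i)) (all≈0 i))))
      (λ x≈0 i → trans (index≈ i) (b-indep coord K-coord (trans (sym x≈) x≈0) i))
      (all? (elem≟0 ∘ index))
      where
      index = λ i → proj₁ (enumerates (coord i) (K-coord i))
      index≈ = λ i → proj₂ (enumerates (coord i) (K-coord i))

open import Data.Nat using (_+_; _*_)

equal-lengths-bound : ∀ {m n} → 2 * n ≤ m → n + n ≤ m × (n + n ≡ m ⇔ (2 * n ≡ m × 2 * n ≡ m))
equal-lengths-bound {m} {n} 2n≤m = ≡.subst (_≤ m) (2*n≡n+n n) 2n≤m ,
  mk⇔ (λ n+n≡m → let 2n≡m = ≡.trans (2*n≡n+n n) n+n≡m in 2n≡m , 2n≡m)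
      (λ (2n≡m , _) → ≡.trans (≡.sym (2*n≡n+n n)) 2n≡m)

distinct-lengths-bound : ∀ {m n₁ n₂} → 2 * n₁ ≤ m → 2 * n₂ ≤ m → n₁ ≢ n₂ → n₁ + n₂ + 1 ≤ m
distinct-lengths-bound {m} {n₁} {n₂} 2n₁≤m 2n₂≤m n₁≢n₂ with ℕₚ.<-cmp n₁ n₂
... | tri< n₁<n₂ _ _ = begin
  n₁ + n₂ + 1   ≡⟨ ℕₚ.+-comm (n₁ + n₂) 1 ⟩
  suc n₁ + n₂   ≤⟨ ℕₚ.+-monoˡ-≤ n₂ n₁<n₂ ⟩
  n₂ + n₂       ≡⟨ 2*n≡n+n n₂ ⟨
  2 * n₂        ≤⟨ 2n₂≤m ⟩
  m             ∎
  where open ℕₚ.≤-Reasoning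
... | tri≈ _ n₁≡n₂ _ = ⊥-elim (n₁≢n₂ n₁≡n₂)
... | tri> _ _ n₂<n₁ = begin
  n₁ + n₂ + 1   ≡⟨ ℕₚ.+-comm (n₁ + n₂) 1 ⟩
  suc n₁ + n₂   ≡⟨ ℕₚ.+-suc n₁ n₂ ⟨
  n₁ + suc n₂   ≤⟨ ℕₚ.+-monoʳ-≤ n₁ n₂<n₁ ⟩
  n₁ + n₁       ≡⟨ 2*n≡n+n n₁ ⟨
  2 * n₁        ≤⟨ 2n₁≤m ⟩
  m             ∎
  where open ℕₚ.≤-Reasoning

twice-length≤degree : ∀ {c ℓ k} {L : CommutativeRing c ℓ} {K : CommutativeRing.Carrier L → Set k}
  {m n₁ n₂ g₁ g₂} → IsFiniteFieldExtension L K m → 1 < n₁ → IsMRD-n1n2-11 L K n₁ n₂ g₁ g₂ → 2 * n₂ ≤ m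
twice-length≤degree {L = L} {K} ext 1<n₁ code = decidable-stable (_ ≤? _) λ 2n₂≰m →
  ¬¬-decidable-≈0 {K = K} finite degree λ _≟0 →
    2n₂≰m (OverSubfield.twice-length≤degree isSubfield isField _≟0 degree 1<n₁ code)
  where
  open IsFiniteFieldExtension ext
  open LinearAlgebra L

theorem2p31 : ∀ {c ℓ k : Level} (L : CommutativeRing c ℓ) (K : CommutativeRing.Carrier L → Set k)
    (m n₁ n₂ : ℕ) → IsFiniteFieldExtension L K m →
    1 < n₁ → n₁ ≤ m → 1 < n₂ → n₂ ≤ m →
    MRDCodeExists L K n₁ n₂ →
    (2 * n₁ ≤ m × 2 * n₂ ≤ m)
    × (n₁ ≡ n₂ → n₁ + n₂ ≤ m × (n₁ + n₂ ≡ m ⇔ (2 * n₁ ≡ m × 2 * n₂ ≡ m)))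
    × (n₁ ≢ n₂ → n₁ + n₂ + 1 ≤ m)
theorem2p31 L K m n₁ n₂ ext 1<n₁ _ 1<n₂ _ (g₁ , g₂ , code) =
  (2n₁≤m , 2n₂≤m) ,
  (λ { ≡.refl → equal-lengths-bound {n = n₁} 2n₁≤m }) ,
  distinct-lengths-bound 2n₁≤m 2n₂≤m
  where
  2n₂≤m : 2 * n₂ ≤ m
  2n₂≤m = twice-length≤degree ext 1<n₁ code
  2n₁≤m : 2 * n₁ ≤ m
  2n₁≤m = twice-length≤degree ext 1<n₂
    (LinearAlgebra.OverSubfield.isMRD-n1n2-11-sym L (IsFiniteFieldExtension.isSubfield ext) code)
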